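{- Let $Q=2^m$, let $a,b\in\mathbb F_Q$, and let $\ell,m$ be distinct non-tangent lines with $\hat\rho(\ell,m)=0$. Let $N$ be the number of non-tangent lines $n$ with $\hat\rho(\ell,n)=a$ and $\hat\rho(n,m)=b$. - If $\ell\in\mathcal L_{ -1}$, then $N=0$. - If $\ell\in\mathcal L_1$, then $N=Q+1$ if $a=b=0$; $N=1$ if $a=b\ne0$; and $N=2$ if $a+b\in T_0^*$.
   Context: Let $Q=2^m$ and work in $\mathrm{PG}(2,Q)$. Conic and lines. - Points are nonzero vectors up to scalars, and $(a,b,c)^\perp$ denotes the line $aX+bY+cZ=0$. - The conic is $\mathcal O=\{(\xi,\xi^2,1)^\top:\xi\in\mathbb F_Q\}\cup\{(0,1,0)^\top\}$. - The non-tangent lines (meeting $\mathcal O$ in $0$ or $2$ points) are exactly the lines $(1,x,y)^\perp$, $x,y\in\mathbb F_Q$. - Such a line lies in $\mathcal L_1$ (secant) if $\mathrm{Tr}(xy)=0$ and in $\mathcal L_{ -1}$ (exterior) if $\mathrm{Tr}(xy)=1$, where $\mathrm{Tr}$ is the absolute trace $\mathbb F_Q\to\mathbb F_2$. Modified cross-ratio. - For $\ell=(1,x,y)^\perp$ and $n=(1,z,u)^\perp$: $\hat\rho(\ell,n)=x^2u^2+y^2z^2+(x+z)(y+u)$. Other notation. - $T_0=\{x\in\mathbb F_Q:\mathrm{Tr}(x)=0\}$ and $T_0^*=T_0\setminus\{0\}$. -}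

module Defs where

open import Level using (0ℓ)
open import Data.Nat using (ℕ; zero; suc; _^_)
open import Data.Product using (_×_; _,_; ∃)
open import Data.List using (List; length; filter; cartesianProduct)
open import Data.List.Membership.Propositional using (_∈_)
open import Data.List.Relation.Unary.Unique.Propositional using (Unique)
open import Relation.Binary.PropositionalEquality using (_≡_; _≢_)
open import Relation.Binary.Definitions using (DecidableEquality)
open import Relation.Nullary.Decidable using (_×-dec_)
open import Algebra.Structures using (IsCommutativeRing)

record GF2^ (m : ℕ) : Set₁ where
  infixl 6 _+_
  infixl 7 _*_
  field
    F      : Set
    _+_    : F → F → F
    _*_    : F → F → F
    -_     : F → F
    0#     : F
    1#     : F
    isCommutativeRing : IsCommutativeRing _≡_ _+_ _*_ -_ 0# 1#
    0≢1    : 0# ≢ 1#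
    inverse : ∀ x → x ≢ 0# → ∃ λ y → x * y ≡ 1#
    _≟_    : DecidableEquality F
    elems  : List F
    elems-unique   : Unique elems
    elems-complete : ∀ x → x ∈ elems
    elems-card     : length elems ≡ 2 ^ m

  Q : ℕ
  Q = 2 ^ m

  frob : ℕ → F → F
  frob zero    x = x
  frob (suc i) x = frob i x * frob i x

  trSum : ℕ → F → F
  trSum zero    x = 0#
  trSum (suc k) x = frob k x + trSum k x

  -- absolute trace F_Q → F_2 (values 0# or 1# in F)
  Tr : F → F
  Tr = trSum m

  -- non-tangent line (1,x,y)^⊥ represented by the pair (x , y)
  Line : Set
  Line = F × F

  sq : F → F
  sq x = x * x

  ρ̂ : Line → Line → F
  ρ̂ (x , y) (z , u) = sq x * sq u + sq y * sq z + (x + z) * (y + u)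

  -- secant lines 𝓛₁ (Tr(xy)=0) and exterior lines 𝓛₋₁ (Tr(xy)=1)
  Secant : Line → Set
  Secant (x , y) = Tr (x * y) ≡ 0#

  Exterior : Line → Set
  Exterior (x , y) = Tr (x * y) ≡ 1#

  allLines : List Line
  allLines = cartesianProduct elems elems

  countN : Line → Line → F → F → ℕ
  countN l mm a b =
    length (filter (λ n → (ρ̂ l n ≟ a) ×-dec (ρ̂ n mm ≟ b)) allLines)

module Submission where

-- Write l = (x , y), m = (z , u), p = x + z, q = y + u and μ (r , s) = p (s + y) + q (r + x).
-- In characteristic 2, ρ̂(n, m) = ρ̂(l, n) + ρ̂(l, m) + ℘ (μ n) with ℘ w = w² + w, and moving n by
-- t (p , q) keeps μ n while adding t μ n + t² ρ̂(l, m) to ρ̂(l, n). So when ρ̂(l, m) = 0, the lines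
-- with μ = 0 are the Q lines of the pencil through l ∩ m, all with ρ̂(l, ·) = 0, and for each μ₀ ≠ 0
-- exactly one line has μ = μ₀ and ρ̂(l, ·) = a. Counting reduces to the roots of ℘ μ = a + b: these
-- are 0 and 1 when a + b = 0, and w, w + 1 with w ∉ {0, 1} when a + b ∈ T₀*, where w exists by
-- additive Hilbert 90 (an element of trace 1 exists since Tr is a polynomial of degree Q/2 < Q).
-- Finally ρ̂(l, m) = (x q + y p)² + p q = 0 forces Tr (x y) = 0, so l is never exterior.

open import Defs
open import Level using (0ℓ)
open import Data.Bool using (true; false)
open import Data.Bool.Properties using (xor-∧-commutativeRing)
open import Data.Empty using (⊥-elim)
open import Data.List using (List; []; _∷_; _++_; length; map; filter; foldr; replicate)
open import Data.List.Membership.Propositional using (_∈_)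
open import Data.List.Membership.Propositional.Properties
  using (∈-filter⁺; ∈-filter⁻; ∈-map⁺; ∈-map⁻; ∈-cartesianProduct⁺; ∈-++⁺ˡ; ∈-++⁺ʳ; ∈-++⁻)
open import Data.List.Membership.Propositional.Properties.WithK using (unique∧set⇒bag)
open import Data.List.Relation.Binary.BagAndSetEquality using (∼bag⇒↭)
open import Data.List.Relation.Binary.Permutation.Propositional using (_↭_; ↭⇒↭ₛ)
open import Data.List.Relation.Binary.Permutation.Propositional.Properties using (↭-length)
open import Data.List.Relation.Unary.Any using (here; there; satisfied)
open import Data.List.Relation.Unary.All as All using (All; []; _∷_)
open import Data.List.Relation.Unary.All.Properties using (++⁻ʳ; ¬All⇒Any¬)
open import Data.List.Properties using (length-++; length-map; length-replicate)
open import Data.List.Relation.Unary.Unique.Propositional using (Unique)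
open import Data.List.Relation.Unary.AllPairs using ([]; _∷_)
import Data.List.Relation.Unary.Unique.Propositional.Properties as Unique
open import Data.Maybe using (just; nothing)
open import Data.Nat as ℕ using (ℕ; zero; suc)
import Data.Nat.Properties as ℕ
open import Data.Product using (_×_; _,_; ∃-syntax; proj₁; proj₂)
open import Data.Sum using (_⊎_; inj₁; inj₂; [_,_]′; reduce; fromInj₂)
open import Function using (_⇔_; mk⇔; Equivalence; _∘_)
open import Relation.Binary.Definitions using (WeaklyDecidable)
open import Relation.Binary.PropositionalEquality
open import Relation.Nullary using (¬_; ¬?; yes; no)
open import Relation.Unary using (Pred; Decidable)
open import Algebra.Bundles using (CommutativeRing; RawRing)
open import Algebra.Structures using (IsCommutativeRing)
open import Algebra.Solver.Ring.AlmostCommutativeRing using (fromCommutativeRing; _-Raw-AlmostCommutative⟶_; Induced-equivalence)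

unique-⇔⇒↭ : ∀ {a} {A : Set a} {xs ys : List A} →
  Unique xs → Unique ys → (∀ {z} → z ∈ xs ⇔ z ∈ ys) → xs ↭ ys
unique-⇔⇒↭ uxs uys xs⇔ys = ∼bag⇒↭ (unique∧set⇒bag uxs uys xs⇔ys)

filter-↭-enumeration : ∀ {a p} {A : Set a} {P : Pred A p} (P? : Decidable P)
  {xs ys : List A} → Unique xs → (∀ x → x ∈ xs) → Unique ys → (∀ {x} → P x ⇔ x ∈ ys) →
  filter P? xs ↭ ys
filter-↭-enumeration P? {xs} uxs complete uys P⇔ = unique-⇔⇒↭ (Unique.filter⁺ P? uxs) uys
  (mk⇔ (λ x∈ → Equivalence.to P⇔ (proj₂ (∈-filter⁻ P? {xs = xs} x∈)))
       (λ x∈ → ∈-filter⁺ P? (complete _) (Equivalence.from P⇔ x∈)))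

module _ {m : ℕ} (K : GF2^ m) where
  open GF2^ K
  open IsCommutativeRing isCommutativeRing
    using (+-identityˡ; +-identityʳ; *-identityˡ; *-identityʳ; +-assoc; *-assoc; +-comm; *-comm;
           zeroˡ; zeroʳ; -‿inverseˡ; -‿inverseʳ; +-isCommutativeMonoid; *-isCommutativeMonoid)

  ring : CommutativeRing 0ℓ 0ℓ
  ring = record { isCommutativeRing = isCommutativeRing }

  open import Algebra.Properties.Group (CommutativeRing.+-group ring) using ()
    renaming (∙-cancelˡ to +-cancelˡ; ∙-cancelʳ to +-cancelʳ)
  open import Algebra.Properties.CommutativeSemigroup (CommutativeRing.+-commutativeSemigroup ring) using ()
    renaming (interchange to +-interchange)
  open import Algebra.Properties.Semiring.Mult (CommutativeRing.semiring ring) using (×1-homo-*) renaming (_×_ to _·_)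
  open import Algebra.Properties.Semiring.Exp (CommutativeRing.semiring ring) using (_^_; ^-homo-*)
  open import Data.List.Relation.Binary.Permutation.Setoid.Properties (setoid F) using (foldr-commMonoid)

  1≢0 : 1# ≢ 0#
  1≢0 1≡0 = 0≢1 (sym 1≡0)

  x*y≡0⇒x≡0∨y≡0 : ∀ {x y} → x * y ≡ 0# → x ≡ 0# ⊎ y ≡ 0#
  x*y≡0⇒x≡0∨y≡0 {x} {y} xy≡0 with x ≟ 0#
  ... | yes x≡0 = inj₁ x≡0
  ... | no x≢0 = inj₂ (begin
      y             ≡⟨ sym (*-identityˡ y) ⟩
      1# * y        ≡⟨ cong (_* y) (trans (sym x*x⁻¹≡1) (*-comm x x⁻¹)) ⟩
      x⁻¹ * x * y   ≡⟨ *-assoc x⁻¹ x y ⟩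
      x⁻¹ * (x * y) ≡⟨ cong (x⁻¹ *_) xy≡0 ⟩
      x⁻¹ * 0#      ≡⟨ zeroʳ x⁻¹ ⟩
      0#            ∎)
    where
    open ≡-Reasoning
    x⁻¹ = proj₁ (inverse x x≢0)
    x*x⁻¹≡1 = proj₂ (inverse x x≢0)

  quotient : ∀ {x} → x ≢ 0# → ∀ c → ∃[ t ] t * x ≡ c
  quotient {x} x≢0 c = c * x⁻¹ , (begin
      c * x⁻¹ * x   ≡⟨ *-assoc c x⁻¹ x ⟩
      c * (x⁻¹ * x) ≡⟨ cong (c *_) (trans (*-comm x⁻¹ x) (proj₂ (inverse x x≢0))) ⟩
      c * 1#        ≡⟨ *-identityʳ c ⟩
      c             ∎)
    where
    open ≡-Reasoning
    x⁻¹ = proj₁ (inverse x x≢0)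

  ∑ ∏ : List F → F
  ∑ = foldr _+_ 0#
  ∏ = foldr _*_ 1#

  ∑-↭ : ∀ {xs ys} → xs ↭ ys → ∑ xs ≡ ∑ ys
  ∑-↭ xs↭ys = foldr-commMonoid +-isCommutativeMonoid (↭⇒↭ₛ xs↭ys)

  ∏-↭ : ∀ {xs ys} → xs ↭ ys → ∏ xs ≡ ∏ ys
  ∏-↭ xs↭ys = foldr-commMonoid *-isCommutativeMonoid (↭⇒↭ₛ xs↭ys)

  -- Characteristic two

  ^≡0⇒≡0 : ∀ {x} n → x ^ n ≡ 0# → x ≡ 0#
  ^≡0⇒≡0 zero 1≡0 = ⊥-elim (1≢0 1≡0)
  ^≡0⇒≡0 (suc n) x^sn≡0 with x*y≡0⇒x≡0∨y≡0 x^sn≡0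
  ... | inj₁ x≡0 = x≡0
  ... | inj₂ x^n≡0 = ^≡0⇒≡0 n x^n≡0

  ∑-translate : ∀ c xs → ∑ (map (_+ c) xs) ≡ ∑ xs + length xs · c
  ∑-translate c [] = sym (+-identityˡ 0#)
  ∑-translate c (x ∷ xs) = trans (cong ((x + c) +_) (∑-translate c xs)) (+-interchange x c (∑ xs) _)

  translation-↭ : ∀ c → map (_+ c) elems ↭ elems
  translation-↭ c = unique-⇔⇒↭ (Unique.map⁺ (+-cancelʳ c _ _) elems-unique) elems-unique
    (λ {z} → mk⇔ (λ _ → elems-complete _) (λ _ → subst (_∈ map (_+ c) elems) (z-c+c z) (∈-map⁺ (_+ c) (elems-complete (z + - c)))))
    where
    z-c+c : ∀ z → z + - c + c ≡ z
    z-c+c z = trans (+-assoc z (- c) c) (trans (cong (z +_) (-‿inverseˡ c)) (+-identityʳ z))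

  Q·1≡0 : Q · 1# ≡ 0#
  Q·1≡0 = +-cancelˡ (∑ elems) _ _ (begin
      ∑ elems + Q · 1#                ≡⟨ cong (λ n → ∑ elems + n · 1#) (sym elems-card) ⟩
      ∑ elems + length elems · 1#     ≡⟨ sym (∑-translate 1# elems) ⟩
      ∑ (map (_+ 1#) elems)           ≡⟨ ∑-↭ (translation-↭ 1#) ⟩
      ∑ elems                         ≡⟨ sym (+-identityʳ _) ⟩
      ∑ elems + 0#                    ∎)
    where open ≡-Reasoning

  2^k·1≡[2·1]^k : ∀ k → (2 ℕ.^ k) · 1# ≡ (2 · 1#) ^ k
  2^k·1≡[2·1]^k zero = +-identityʳ 1#
  2^k·1≡[2·1]^k (suc k) = trans (×1-homo-* 2 (2 ℕ.^ k)) (cong ((2 · 1#) *_) (2^k·1≡[2·1]^k k))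

  1+1≡0 : 1# + 1# ≡ 0#
  1+1≡0 = trans (cong (1# +_) (sym (+-identityʳ 1#))) (^≡0⇒≡0 m (trans (sym (2^k·1≡[2·1]^k m)) Q·1≡0))

  -1≡1 : - 1# ≡ 1#
  -1≡1 = +-cancelˡ 1# _ _ (trans (-‿inverseʳ 1#) (sym 1+1≡0))

  𝔽₂ : RawRing 0ℓ 0ℓ
  𝔽₂ = CommutativeRing.rawRing xor-∧-commutativeRing

  𝔽₂⟶F : 𝔽₂ -Raw-AlmostCommutative⟶ fromCommutativeRing ring
  𝔽₂⟶F = record
    { ⟦_⟧    = λ { false → 0# ; true → 1# }
    ; +-homo = λ { false _ → sym (+-identityˡ _) ; true false → sym (+-identityʳ 1#) ; true true → sym 1+1≡0 }
    ; *-homo = λ { false _ → sym (zeroˡ _) ; true _ → sym (*-identityˡ _) }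
    ; -‿homo = λ { false → sym (trans (sym (+-identityˡ (- 0#))) (-‿inverseʳ 0#)) ; true → sym -1≡1 }
    ; 0-homo = refl
    ; 1-homo = refl
    }

  -- Normalising with coefficients in 𝔽₂ lets the ring solver prove identities of characteristic 2.
  _≟𝔽₂_ : WeaklyDecidable (Induced-equivalence 𝔽₂⟶F)
  false ≟𝔽₂ false = just refl
  true ≟𝔽₂ true = just refl
  _ ≟𝔽₂ _ = nothing

  open import Algebra.Solver.Ring 𝔽₂ (fromCommutativeRing ring) 𝔽₂⟶F _≟𝔽₂_

  x+x≡0 : ∀ x → x + x ≡ 0#
  x+x≡0 = solve 1 (λ x → x :+ x := con false) refl

  x+y≡0⇒x≡y : ∀ {x y} → x + y ≡ 0# → x ≡ y
  x+y≡0⇒x≡y {x} {y} x+y≡0 = begin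
    x              ≡⟨ solve 2 (λ x y → x := (x :+ y) :+ y) refl x y ⟩
    (x + y) + y    ≡⟨ cong (_+ y) x+y≡0 ⟩
    0# + y         ≡⟨ +-identityˡ y ⟩
    y              ∎
    where open ≡-Reasoning

  x≡y+z⇒y≡x+z : ∀ {x y z} → x ≡ y + z → y ≡ x + z
  x≡y+z⇒y≡x+z {x} {y} {z} x≡y+z = begin
    y              ≡⟨ solve 2 (λ y z → y := (y :+ z) :+ z) refl y z ⟩
    (y + z) + z    ≡⟨ cong (_+ z) (sym x≡y+z) ⟩
    x + z          ∎
    where open ≡-Reasoning

  x+y≡z⇒y≡x+z : ∀ {x y z} → x + y ≡ z → y ≡ x + z
  x+y≡z⇒y≡x+z {x} {y} {z} x+y≡z = begin
    y              ≡⟨ solve 2 (λ x y → y := x :+ (x :+ y)) refl x y ⟩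
    x + (x + y)    ≡⟨ cong (x +_) x+y≡z ⟩
    x + z          ∎
    where open ≡-Reasoning

  *-cancelʳ-≢0 : ∀ {x y z} → z ≢ 0# → x * z ≡ y * z → x ≡ y
  *-cancelʳ-≢0 {x} {y} {z} z≢0 xz≡yz with x*y≡0⇒x≡0∨y≡0 x+y*z≡0
    where
    x+y*z≡0 : (x + y) * z ≡ 0#
    x+y*z≡0 = trans (solve 3 (λ x y z → (x :+ y) :* z := x :* z :+ y :* z) refl x y z)
                    (trans (cong (_+ y * z) xz≡yz) (x+x≡0 (y * z)))
  ... | inj₁ x+y≡0 = x+y≡0⇒x≡y x+y≡0
  ... | inj₂ z≡0 = ⊥-elim (z≢0 z≡0)

  collinear : ∀ {p q r s} → p ≢ 0# ⊎ q ≢ 0# → p * s + q * r ≡ 0# → ∃[ t ] r ≡ t * p × s ≡ t * q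
  collinear {p} {q} {r} {s} (inj₁ p≢0) ps+qr≡0 with quotient p≢0 r
  ... | t , tp≡r = t , sym tp≡r , *-cancelʳ-≢0 p≢0 (begin
    s * p         ≡⟨ *-comm s p ⟩
    p * s         ≡⟨ x+y≡0⇒x≡y ps+qr≡0 ⟩
    q * r         ≡⟨ cong (q *_) (sym tp≡r) ⟩
    q * (t * p)   ≡⟨ solve 3 (λ q t p → q :* (t :* p) := (t :* q) :* p) refl q t p ⟩
    t * q * p     ∎)
    where open ≡-Reasoning
  collinear {p} {q} {r} {s} (inj₂ q≢0) ps+qr≡0 with collinear (inj₁ q≢0) (trans (+-comm (q * r) (p * s)) ps+qr≡0)
  ... | t , s≡tq , r≡tp = t , r≡tp , s≡tq

  -- Fermat's little theorem

  nonzeros : List F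
  nonzeros = filter (λ x → ¬? (x ≟ 0#)) elems

  ∈-nonzeros⇔≢0 : ∀ {x} → x ∈ nonzeros ⇔ x ≢ 0#
  ∈-nonzeros⇔≢0 = mk⇔ (λ x∈ → proj₂ (∈-filter⁻ (λ x → ¬? (x ≟ 0#)) {xs = elems} x∈))
                      (∈-filter⁺ (λ x → ¬? (x ≟ 0#)) (elems-complete _))

  1+length-nonzeros≡Q : suc (length nonzeros) ≡ Q
  1+length-nonzeros≡Q = trans (sym (↭-length elems↭0∷nonzeros)) elems-card
    where
    0∉nonzeros : All (0# ≢_) nonzeros
    0∉nonzeros = All.tabulate (λ x∈ 0≡x → Equivalence.to ∈-nonzeros⇔≢0 x∈ (sym 0≡x))
    ∈-0∷nonzeros : ∀ x → x ∈ 0# ∷ nonzeros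
    ∈-0∷nonzeros x with x ≟ 0#
    ... | yes x≡0 = here x≡0
    ... | no x≢0 = there (Equivalence.from ∈-nonzeros⇔≢0 x≢0)
    elems↭0∷nonzeros : elems ↭ 0# ∷ nonzeros
    elems↭0∷nonzeros = unique-⇔⇒↭ elems-unique (0∉nonzeros ∷ Unique.filter⁺ _ elems-unique)
      (mk⇔ (λ _ → ∈-0∷nonzeros _) (λ _ → elems-complete _))

  ∏-≢0 : ∀ {xs} → All (_≢ 0#) xs → ∏ xs ≢ 0#
  ∏-≢0 [] = 1≢0
  ∏-≢0 (x≢0 ∷ xs≢0) ∏≡0 with x*y≡0⇒x≡0∨y≡0 ∏≡0
  ... | inj₁ x≡0 = x≢0 x≡0
  ... | inj₂ ∏xs≡0 = ∏-≢0 xs≢0 ∏xs≡0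

  ∏-scale : ∀ c xs → ∏ (map (c *_) xs) ≡ c ^ length xs * ∏ xs
  ∏-scale c [] = sym (*-identityˡ 1#)
  ∏-scale c (x ∷ xs) = trans (cong (c * x *_) (∏-scale c xs))
    (solve 4 (λ c x cⁿ P → c :* x :* (cⁿ :* P) := c :* cⁿ :* (x :* P)) refl c x (c ^ length xs) (∏ xs))

  scaling-↭ : ∀ {c} → c ≢ 0# → map (c *_) nonzeros ↭ nonzeros
  scaling-↭ {c} c≢0 = unique-⇔⇒↭ (Unique.map⁺ c*-injective (Unique.filter⁺ _ elems-unique)) (Unique.filter⁺ _ elems-unique)
    (mk⇔ ⇒nonzero ⇐nonzero)
    where
    c*-injective : ∀ {x y} → c * x ≡ c * y → x ≡ y
    c*-injective {x} {y} cx≡cy = *-cancelʳ-≢0 c≢0 (trans (*-comm x c) (trans cx≡cy (*-comm c y)))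
    ⇒nonzero : ∀ {z} → z ∈ map (c *_) nonzeros → z ∈ nonzeros
    ⇒nonzero z∈ with ∈-map⁻ (c *_) z∈
    ... | y , y∈ , refl = Equivalence.from ∈-nonzeros⇔≢0 λ cy≡0 →
      [ c≢0 , Equivalence.to ∈-nonzeros⇔≢0 y∈ ]′ (x*y≡0⇒x≡0∨y≡0 cy≡0)
    ⇐nonzero : ∀ {z} → z ∈ nonzeros → z ∈ map (c *_) nonzeros
    ⇐nonzero {z} z∈ with quotient c≢0 z
    ... | t , tc≡z = subst (_∈ map (c *_) nonzeros) (trans (*-comm c t) tc≡z)
      (∈-map⁺ (c *_) (Equivalence.from ∈-nonzeros⇔≢0 λ t≡0 →
        Equivalence.to ∈-nonzeros⇔≢0 z∈ (trans (sym tc≡z) (trans (cong (_* c) t≡0) (zeroˡ c)))))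

  fermat : ∀ x → x ^ Q ≡ x
  fermat x with x ≟ 0#
  ... | yes refl = subst (λ n → 0# ^ n ≡ 0#) 1+length-nonzeros≡Q (zeroˡ _)
  ... | no x≢0 = subst (λ n → x ^ n ≡ x) 1+length-nonzeros≡Q
    (trans (cong (x *_) xⁿ≡1) (*-identityʳ x))
    where
    xⁿ≡1 : x ^ length nonzeros ≡ 1#
    xⁿ≡1 = *-cancelʳ-≢0 (∏-≢0 (All.tabulate (Equivalence.to ∈-nonzeros⇔≢0))) (begin
      x ^ length nonzeros * ∏ nonzeros   ≡⟨ sym (∏-scale x nonzeros) ⟩
      ∏ (map (x *_) nonzeros)            ≡⟨ ∏-↭ (scaling-↭ x≢0) ⟩
      ∏ nonzeros                         ≡⟨ sym (*-identityˡ _) ⟩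
      1# * ∏ nonzeros                    ∎)
      where open ≡-Reasoning

  -- Frobenius, trace and the Artin–Schreier map

  sq-+ : ∀ x y → sq (x + y) ≡ sq x + sq y
  sq-+ = solve 2 (λ x y → (x :+ y) :* (x :+ y) := x :* x :+ y :* y) refl

  sq-* : ∀ x y → sq (x * y) ≡ sq x * sq y
  sq-* = solve 2 (λ x y → (x :* y) :* (x :* y) := (x :* x) :* (y :* y)) refl

  frob-+ : ∀ k x y → frob k (x + y) ≡ frob k x + frob k y
  frob-+ zero x y = refl
  frob-+ (suc k) x y = trans (cong sq (frob-+ k x y)) (sq-+ _ _)

  frob-* : ∀ k x y → frob k (x * y) ≡ frob k x * frob k y
  frob-* zero x y = refl
  frob-* (suc k) x y = trans (cong sq (frob-* k x y)) (sq-* _ _)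

  frob-sq : ∀ k x → frob k (sq x) ≡ frob (suc k) x
  frob-sq k x = frob-* k x x

  frob≡^ : ∀ k x → frob k x ≡ x ^ (2 ℕ.^ k)
  frob≡^ zero x = sym (*-identityʳ x)
  frob≡^ (suc k) x = trans (cong₂ _*_ (frob≡^ k x) (frob≡^ k x))
    (sym (trans (cong (λ j → x ^ (2 ℕ.^ k ℕ.+ j)) (ℕ.+-identityʳ (2 ℕ.^ k))) (^-homo-* x (2 ℕ.^ k) (2 ℕ.^ k))))

  frob-m : ∀ x → frob m x ≡ x
  frob-m x = trans (frob≡^ m x) (fermat x)

  trSum-+ : ∀ k x y → trSum k (x + y) ≡ trSum k x + trSum k y
  trSum-+ zero x y = sym (+-identityˡ 0#)
  trSum-+ (suc k) x y = trans (cong₂ _+_ (frob-+ k x y) (trSum-+ k x y)) (+-interchange _ _ _ _)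

  sq-trSum : ∀ k x → sq (trSum k x) ≡ trSum k (sq x)
  sq-trSum zero x = zeroˡ 0#
  sq-trSum (suc k) x = trans (sq-+ _ _) (cong₂ _+_ (sym (frob-sq k x)) (sq-trSum k x))

  trSum-suc : ∀ k x → trSum (suc k) x ≡ trSum k (sq x) + x
  trSum-suc zero x = +-comm x 0#
  trSum-suc (suc k) x = trans (cong₂ _+_ (sym (frob-sq k x)) (trSum-suc k x)) (sym (+-assoc _ _ x))

  Tr-+ : ∀ x y → Tr (x + y) ≡ Tr x + Tr y
  Tr-+ = trSum-+ m

  Tr-sq : ∀ x → Tr (sq x) ≡ Tr x
  Tr-sq x = +-cancelʳ x _ _ (begin
    Tr (sq x) + x     ≡⟨ sym (trSum-suc m x) ⟩
    frob m x + Tr x   ≡⟨ cong (_+ Tr x) (frob-m x) ⟩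
    x + Tr x          ≡⟨ +-comm x (Tr x) ⟩
    Tr x + x          ∎)
    where open ≡-Reasoning

  ℘ : F → F
  ℘ w = sq w + w

  Tr-℘ : ∀ w → Tr (℘ w) ≡ 0#
  Tr-℘ w = trans (Tr-+ (sq w) w) (trans (cong (_+ Tr w) (Tr-sq w)) (x+x≡0 (Tr w)))

  ℘-fibre : ∀ {x w} → ℘ x ≡ ℘ w → x ≡ w ⊎ x ≡ w + 1#
  ℘-fibre {x} {w} ℘x≡℘w with x*y≡0⇒x≡0∨y≡0 factorisation
    where
    factorisation : (x + w) * (x + (w + 1#)) ≡ 0#
    factorisation = begin
      (x + w) * (x + (w + 1#)) ≡⟨ solve 2 (λ x w → (x :+ w) :* (x :+ (w :+ con true)) := (x :* x :+ x) :+ (w :* w :+ w)) refl x w ⟩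
      ℘ x + ℘ w                ≡⟨ cong (_+ ℘ w) ℘x≡℘w ⟩
      ℘ w + ℘ w                ≡⟨ x+x≡0 (℘ w) ⟩
      0#                       ∎
      where open ≡-Reasoning
  ... | inj₁ x+w≡0 = inj₁ (x+y≡0⇒x≡y x+w≡0)
  ... | inj₂ x+w+1≡0 = inj₂ (x+y≡0⇒x≡y x+w+1≡0)

  ℘0≡0 : ℘ 0# ≡ 0#
  ℘0≡0 = solve 0 (con false :* con false :+ con false := con false) refl

  ℘1≡0 : ℘ 1# ≡ 0#
  ℘1≡0 = solve 0 (con true :* con true :+ con true := con false) refl

  ℘≡0⇒0∨1 : ∀ {x} → ℘ x ≡ 0# → x ≡ 0# ⊎ x ≡ 1#
  ℘≡0⇒0∨1 ℘x≡0 with ℘-fibre (trans ℘x≡0 (sym ℘0≡0))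
  ... | inj₁ x≡0 = inj₁ x≡0
  ... | inj₂ x≡0+1 = inj₂ (trans x≡0+1 (+-identityˡ 1#))

  Tr-01 : ∀ x → Tr x ≡ 0# ⊎ Tr x ≡ 1#
  Tr-01 x = ℘≡0⇒0∨1 (trans (cong (_+ Tr x) (trans (sq-trSum m x) (Tr-sq x))) (x+x≡0 (Tr x)))

  -- With X p = x² q one has p² (℘ X + (x y)²) = x² ((x q + y p)² + p q).
  Tr[xy]≡0 : ∀ {x y p q} → p ≢ 0# ⊎ q ≢ 0# → sq (x * q + y * p) + p * q ≡ 0# → Tr (x * y) ≡ 0#
  Tr[xy]≡0 {x} {y} {p} {q} (inj₁ p≢0) eq with quotient p≢0 (sq x * q)
  ... | X , Xp≡x²q = begin
    Tr (x * y)          ≡⟨ sym (Tr-sq (x * y)) ⟩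
    Tr (sq (x * y))     ≡⟨ cong Tr (sym ℘X≡[xy]²) ⟩
    Tr (℘ X)            ≡⟨ Tr-℘ X ⟩
    0#                  ∎
    where
    open ≡-Reasoning
    p²[℘X+[xy]²]≡0 : sq p * (℘ X + sq (x * y)) ≡ 0#
    p²[℘X+[xy]²]≡0 = begin
      sq p * (℘ X + sq (x * y))
        ≡⟨ solve 4 (λ p X x y → (p :* p) :* ((X :* X :+ X) :+ (x :* y) :* (x :* y))
                             := (X :* p) :* (X :* p) :+ (X :* p) :* p :+ ((x :* y) :* (x :* y)) :* (p :* p)) refl p X x y ⟩
      sq (X * p) + X * p * p + sq (x * y) * sq p
        ≡⟨ cong (λ e → sq e + e * p + sq (x * y) * sq p) Xp≡x²q ⟩
      sq (sq x * q) + sq x * q * p + sq (x * y) * sq p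
        ≡⟨ solve 4 (λ x y p q → ((x :* x) :* q) :* ((x :* x) :* q) :+ (x :* x) :* q :* p :+ ((x :* y) :* (x :* y)) :* (p :* p)
                             := (x :* x) :* ((x :* q :+ y :* p) :* (x :* q :+ y :* p) :+ p :* q)) refl x y p q ⟩
      sq x * (sq (x * q + y * p) + p * q)
        ≡⟨ cong (sq x *_) eq ⟩
      sq x * 0#
        ≡⟨ zeroʳ (sq x) ⟩
      0# ∎
    ℘X≡[xy]² : ℘ X ≡ sq (x * y)
    ℘X≡[xy]² with x*y≡0⇒x≡0∨y≡0 p²[℘X+[xy]²]≡0
    ... | inj₁ p²≡0 = ⊥-elim (p≢0 (reduce (x*y≡0⇒x≡0∨y≡0 p²≡0)))
    ... | inj₂ ℘X+[xy]²≡0 = x+y≡0⇒x≡y ℘X+[xy]²≡0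
  Tr[xy]≡0 {x} {y} {p} {q} (inj₂ q≢0) eq = trans (cong Tr (*-comm x y)) (Tr[xy]≡0 (inj₁ q≢0)
    (trans (solve 4 (λ x y p q → (y :* p :+ x :* q) :* (y :* p :+ x :* q) :+ q :* p
                              := (x :* q :+ y :* p) :* (x :* q :+ y :* p) :+ p :* q) refl x y p q) eq))

  -- Polynomials and the existence of an element of trace one

  eval : List F → F → F
  eval [] x = 0#
  eval (c ∷ cs) x = c + x * eval cs x

  -- quot r cs is the quotient of x·p(x) − r·p(r) by x − r, where eval cs = p.
  quot : F → List F → List F
  quot r [] = []
  quot r (c ∷ cs) = eval (c ∷ cs) r ∷ quot r cs

  length-quot : ∀ r cs → length (quot r cs) ≡ length cs
  length-quot r [] = refl
  length-quot r (c ∷ cs) = cong suc (length-quot r cs)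

  quot-spec : ∀ r cs x → x * eval cs x + r * eval cs r ≡ (x + r) * eval (quot r cs) x
  quot-spec r [] x = solve 2 (λ x r → x :* con false :+ r :* con false := (x :+ r) :* con false) refl x r
  quot-spec r (c ∷ cs) x = begin
    x * (c + x * eval cs x) + r * (c + r * eval cs r)
      ≡⟨ solve 5 (λ x r c Ex Er → x :* (c :+ x :* Ex) :+ r :* (c :+ r :* Er)
                               := (x :+ r) :* (c :+ r :* Er) :+ x :* (x :* Ex :+ r :* Er))
               refl x r c (eval cs x) (eval cs r) ⟩
    (x + r) * eval (c ∷ cs) r + x * (x * eval cs x + r * eval cs r)
      ≡⟨ cong (λ e → (x + r) * eval (c ∷ cs) r + x * e) (quot-spec r cs x) ⟩
    (x + r) * eval (c ∷ cs) r + x * ((x + r) * eval (quot r cs) x)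
      ≡⟨ solve 4 (λ x r E Qx → (x :+ r) :* E :+ x :* ((x :+ r) :* Qx) := (x :+ r) :* (E :+ x :* Qx))
               refl x r (eval (c ∷ cs) r) (eval (quot r cs) x) ⟩
    (x + r) * eval (quot r (c ∷ cs)) x ∎
    where open ≡-Reasoning

  quot-roots : ∀ {r r′} c cs → r ≢ r′ → eval (c ∷ cs) r ≡ 0# → eval (c ∷ cs) r′ ≡ 0# →
    eval (quot r cs) r′ ≡ 0#
  quot-roots {r} {r′} c cs r≢r′ root root′ with x*y≡0⇒x≡0∨y≡0 r′+r*q≡0
    where
    r′+r*q≡0 : (r′ + r) * eval (quot r cs) r′ ≡ 0#
    r′+r*q≡0 = begin
      (r′ + r) * eval (quot r cs) r′                 ≡⟨ sym (quot-spec r cs r′) ⟩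
      r′ * eval cs r′ + r * eval cs r                ≡⟨ solve 5 (λ c r r′ E E′ → r′ :* E′ :+ r :* E := (c :+ r′ :* E′) :+ (c :+ r :* E)) refl c r r′ (eval cs r) (eval cs r′) ⟩
      eval (c ∷ cs) r′ + eval (c ∷ cs) r             ≡⟨ cong₂ _+_ root′ root ⟩
      0# + 0#                                        ≡⟨ +-identityʳ 0# ⟩
      0#                                             ∎
      where open ≡-Reasoning
  ... | inj₁ r′+r≡0 = ⊥-elim (r≢r′ (sym (x+y≡0⇒x≡y r′+r≡0)))
  ... | inj₂ q≡0 = q≡0

  quot-zero : ∀ {r} c cs → All (_≡ 0#) (quot r cs) → eval (c ∷ cs) r ≡ 0# → All (_≡ 0#) (c ∷ cs)
  quot-zero {r} c [] [] root = trans (sym (trans (cong (c +_) (zeroʳ r)) (+-identityʳ c))) root ∷ []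
  quot-zero {r} c (d ∷ ds) (root′ ∷ zeros) root =
    trans (sym (trans (cong (λ e → c + r * e) root′) (trans (cong (c +_) (zeroʳ r)) (+-identityʳ c)))) root
    ∷ quot-zero d ds zeros root′

  root-bound : ∀ cs {rs} → Unique rs → All (λ r → eval cs r ≡ 0#) rs → length cs ℕ.≤ length rs →
    All (_≡ 0#) cs
  root-bound [] _ _ _ = []
  root-bound (c ∷ cs) {r ∷ rs} (r∉rs ∷ urs) (root ∷ roots) (ℕ.s≤s cs≤rs) = quot-zero c cs
    (root-bound (quot r cs) urs (All.zipWith (λ (r≢r′ , root′) → quot-roots c cs r≢r′ root root′) (r∉rs , roots))
      (subst (ℕ._≤ length rs) (sym (length-quot r cs)) cs≤rs))
    root

  eval-++ : ∀ as bs x → eval (as ++ bs) x ≡ eval as x + x ^ length as * eval bs x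
  eval-++ [] bs x = sym (trans (+-identityˡ _) (*-identityˡ _))
  eval-++ (a ∷ as) bs x = trans (cong (λ e → a + x * e) (eval-++ as bs x))
    (solve 5 (λ a x E xⁿ B → a :+ x :* (E :+ xⁿ :* B) := (a :+ x :* E) :+ (x :* xⁿ) :* B)
           refl a x (eval as x) (x ^ length as) (eval bs x))

  eval-replicate-0 : ∀ n x → eval (replicate n 0#) x ≡ 0#
  eval-replicate-0 zero x = refl
  eval-replicate-0 (suc n) x = trans (cong (λ e → 0# + x * e) (eval-replicate-0 n x))
    (trans (+-identityˡ _) (zeroʳ x))

  -- The coefficients of trSum k, constant term first, padded with zeros to length 2 ^ k.
  trSumCoeffs : ℕ → List F
  trSumCoeffs zero = 0# ∷ []
  trSumCoeffs (suc k) = trSumCoeffs k ++ 1# ∷ replicate (ℕ.pred (2 ℕ.^ k)) 0#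

  length-trSumCoeffs : ∀ k → length (trSumCoeffs k) ≡ 2 ℕ.^ k
  length-trSumCoeffs zero = refl
  length-trSumCoeffs (suc k) = begin
    length (trSumCoeffs k ++ 1# ∷ replicate (ℕ.pred (2 ℕ.^ k)) 0#)
      ≡⟨ length-++ (trSumCoeffs k) ⟩
    length (trSumCoeffs k) ℕ.+ suc (length (replicate (ℕ.pred (2 ℕ.^ k)) 0#))
      ≡⟨ cong₂ (λ a b → a ℕ.+ suc b) (length-trSumCoeffs k) (length-replicate (ℕ.pred (2 ℕ.^ k))) ⟩
    2 ℕ.^ k ℕ.+ suc (ℕ.pred (2 ℕ.^ k))
      ≡⟨ cong (2 ℕ.^ k ℕ.+_) (trans (ℕ.suc-pred (2 ℕ.^ k) {{ℕ.m^n≢0 2 k}}) (sym (ℕ.+-identityʳ _))) ⟩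
    2 ℕ.^ suc k ∎
    where open ≡-Reasoning

  eval-++-monomial : ∀ cs n x → eval (cs ++ 1# ∷ replicate n 0#) x ≡ eval cs x + x ^ length cs
  eval-++-monomial cs n x = begin
    eval (cs ++ 1# ∷ replicate n 0#) x                         ≡⟨ eval-++ cs _ x ⟩
    eval cs x + x ^ length cs * (1# + x * eval (replicate n 0#) x)
      ≡⟨ cong (λ e → eval cs x + x ^ length cs * (1# + x * e)) (eval-replicate-0 n x) ⟩
    eval cs x + x ^ length cs * (1# + x * 0#)
      ≡⟨ solve 3 (λ E x X → E :+ X :* (con true :+ x :* con false) := E :+ X) refl (eval cs x) x (x ^ length cs) ⟩
    eval cs x + x ^ length cs                                  ∎
    where open ≡-Reasoning

  eval-trSumCoeffs : ∀ k x → eval (trSumCoeffs k) x ≡ trSum k x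
  eval-trSumCoeffs-++ : ∀ k n x → eval (trSumCoeffs k ++ 1# ∷ replicate n 0#) x ≡ trSum (suc k) x

  eval-trSumCoeffs zero x = trans (cong (0# +_) (zeroʳ x)) (+-identityˡ 0#)
  eval-trSumCoeffs (suc k) = eval-trSumCoeffs-++ k _

  eval-trSumCoeffs-++ k n x = begin
    eval (trSumCoeffs k ++ 1# ∷ replicate n 0#) x         ≡⟨ eval-++-monomial (trSumCoeffs k) n x ⟩
    eval (trSumCoeffs k) x + x ^ length (trSumCoeffs k)
      ≡⟨ cong₂ (λ e n → e + x ^ n) (eval-trSumCoeffs k x) (length-trSumCoeffs k) ⟩
    trSum k x + x ^ (2 ℕ.^ k)                             ≡⟨ +-comm _ _ ⟩
    x ^ (2 ℕ.^ k) + trSum k x                             ≡⟨ cong (_+ trSum k x) (sym (frob≡^ k x)) ⟩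
    trSum (suc k) x                                       ∎
    where open ≡-Reasoning

  trSum-nonvanishing : ∀ k → 2 ℕ.^ k ℕ.< Q → ¬ (∀ x → trSum (suc k) x ≡ 0#)
  trSum-nonvanishing k 2^k<Q trSum≡0 = 0≢1 (sym (All.head (++⁻ʳ (trSumCoeffs k) coeffs≡0)))
    where
    coeffs : List F
    coeffs = trSumCoeffs k ++ 1# ∷ []
    coeffs≡0 : All (_≡ 0#) coeffs
    coeffs≡0 = root-bound coeffs elems-unique
      (All.tabulate (λ {x} _ → trans (eval-trSumCoeffs-++ k 0 x) (trSum≡0 x)))
      (subst₂ ℕ._≤_ (sym (trans (length-++ (trSumCoeffs k)) (cong (ℕ._+ 1) (length-trSumCoeffs k))))
                    (sym elems-card) (subst (ℕ._≤ Q) (ℕ.+-comm 1 (2 ℕ.^ k)) 2^k<Q))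

  Q≢1 : Q ≢ 1
  Q≢1 Q≡1 with elems | trans elems-card Q≡1 | elems-complete 0# | elems-complete 1#
  ... | e ∷ [] | _ | here 0≡e | here 1≡e = 0≢1 (trans 0≡e (sym 1≡e))

  m≡suc : ∃[ k ] m ≡ suc k
  m≡suc = exponent-≢0 m Q≢1
    where
    exponent-≢0 : ∀ n → 2 ℕ.^ n ≢ 1 → ∃[ k ] n ≡ suc k
    exponent-≢0 zero 1≢1 = ⊥-elim (1≢1 refl)
    exponent-≢0 (suc k) _ = k , refl

  Tr-nonvanishing : ¬ (∀ x → Tr x ≡ 0#)
  Tr-nonvanishing Tr≡0 with m≡suc
  ... | k , m≡1+k = trSum-nonvanishing k
    (subst (λ n → 2 ℕ.^ k ℕ.< 2 ℕ.^ n) (sym m≡1+k) (ℕ.^-monoʳ-< 2 (ℕ.s≤s (ℕ.s≤s ℕ.z≤n)) (ℕ.n<1+n k)))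
    (subst (λ n → ∀ x → trSum n x ≡ 0#) m≡1+k Tr≡0)

  ∃Tr≡1 : ∃[ δ ] Tr δ ≡ 1#
  ∃Tr≡1 with All.all? (λ x → Tr x ≟ 0#) elems
  ... | yes Tr≡0 = ⊥-elim (Tr-nonvanishing (λ x → All.lookup Tr≡0 (elems-complete x)))
  ... | no Tr≢0 with satisfied (¬All⇒Any¬ (λ x → Tr x ≟ 0#) elems Tr≢0)
  ...   | δ , Trδ≢0 = δ , fromInj₂ (⊥-elim ∘ Trδ≢0) (Tr-01 δ)

  asSolution : F → F → ℕ → F
  asSolution c δ zero = 0#
  asSolution c δ (suc k) = asSolution c δ k + trSum k c * frob k δ

  ℘-asSolution : ∀ c δ k → ℘ (asSolution c δ k) ≡ frob k δ * (trSum k c + c) + c * (trSum k δ + δ)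
  ℘-asSolution c δ zero = solve 2 (λ c δ → con false :* con false :+ con false := δ :* (con false :+ c) :+ c :* (con false :+ δ)) refl c δ
  ℘-asSolution c δ (suc k) = begin
    ℘ (W + T * D)
      ≡⟨ solve 3 (λ W T D → (W :+ T :* D) :* (W :+ T :* D) :+ (W :+ T :* D) := (W :* W :+ W) :+ ((T :* T) :* (D :* D) :+ T :* D)) refl W T D ⟩
    ℘ W + (sq T * sq D + T * D)
      ≡⟨ cong₂ (λ e t → e + (t * sq D + T * D)) (℘-asSolution c δ k) sqT ⟩
    (D * (T + c) + c * (S + δ)) + (((frob k c + T) + c) * sq D + T * D)
      ≡⟨ solve 6 (λ D T c S δ Fc → (D :* (T :+ c) :+ c :* (S :+ δ)) :+ (((Fc :+ T) :+ c) :* (D :* D) :+ T :* D)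
                                 := (D :* D) :* ((Fc :+ T) :+ c) :+ c :* ((D :+ S) :+ δ)) refl D T c S δ (frob k c) ⟩
    sq D * ((frob k c + T) + c) + c * ((D + S) + δ)
      ∎
    where
    open ≡-Reasoning
    W = asSolution c δ k
    T = trSum k c
    D = frob k δ
    S = trSum k δ
    sqT : sq T ≡ (frob k c + T) + c
    sqT = trans (sq-trSum k c) (x≡y+z⇒y≡x+z (trSum-suc k c))

  ℘-onto-T₀ : ∀ {c} → Tr c ≡ 0# → ∃[ w ] ℘ w ≡ c
  ℘-onto-T₀ {c} Trc≡0 with ∃Tr≡1
  ... | δ , Trδ≡1 = asSolution c δ m , (begin
    ℘ (asSolution c δ m)                      ≡⟨ ℘-asSolution c δ m ⟩
    frob m δ * (Tr c + c) + c * (Tr δ + δ)    ≡⟨ cong₂ (λ d t → d * (t + c) + c * (Tr δ + δ)) (frob-m δ) Trc≡0 ⟩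
    δ * (0# + c) + c * (Tr δ + δ)             ≡⟨ cong (λ t → δ * (0# + c) + c * (t + δ)) Trδ≡1 ⟩
    δ * (0# + c) + c * (1# + δ)               ≡⟨ solve 2 (λ δ c → δ :* (con false :+ c) :+ c :* (con true :+ δ) := c) refl δ c ⟩
    c                                         ∎)
    where open ≡-Reasoning

  -- Counting lines relative to l and mm

  countN-enumeration : ∀ {l mm a b} {S : List Line} → Unique S →
    (∀ {n} → (ρ̂ l n ≡ a × ρ̂ n mm ≡ b) ⇔ n ∈ S) → countN l mm a b ≡ length S
  countN-enumeration uS Sol⇔∈S = ↭-length (filter-↭-enumeration _
    (Unique.cartesianProduct⁺ elems-unique elems-unique)
    (λ (r , s) → ∈-cartesianProduct⁺ (elems-complete r) (elems-complete s)) uS Sol⇔∈S)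

  module Pencil (x y z u : F) where
    l mm : Line
    l = x , y
    mm = z , u

    p q : F
    p = x + z
    q = y + u

    -- μ n evaluates the equation of n at the point l ∩ mm = (x q + y p : q : p).
    μ : Line → F
    μ (r , s) = p * (s + y) + q * (r + x)

    shift : F → Line → Line
    shift t (r , s) = r + t * p , s + t * q

    pencil : F → Line
    pencil t = shift t l

    ρ̂-decomposition : ∀ n → ρ̂ n mm ≡ ρ̂ l n + ρ̂ l mm + ℘ (μ n)
    ρ̂-decomposition (r , s) = solve 6 (λ x y z u r s →
        (r :* r) :* (u :* u) :+ (s :* s) :* (z :* z) :+ (r :+ z) :* (s :+ u)
      := ((x :* x) :* (s :* s) :+ (y :* y) :* (r :* r) :+ (x :+ r) :* (y :+ s))
         :+ ((x :* x) :* (u :* u) :+ (y :* y) :* (z :* z) :+ (x :+ z) :* (y :+ u))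
         :+ (((x :+ z) :* (s :+ y) :+ (y :+ u) :* (r :+ x)) :* ((x :+ z) :* (s :+ y) :+ (y :+ u) :* (r :+ x))
             :+ ((x :+ z) :* (s :+ y) :+ (y :+ u) :* (r :+ x)))) refl x y z u r s

    ρ̂-shift : ∀ t n → ρ̂ l (shift t n) ≡ ρ̂ l n + t * μ n + sq t * ρ̂ l mm
    ρ̂-shift t (r , s) = solve 7 (λ x y z u r s t →
        (x :* x) :* ((s :+ t :* (y :+ u)) :* (s :+ t :* (y :+ u))) :+ (y :* y) :* ((r :+ t :* (x :+ z)) :* (r :+ t :* (x :+ z)))
          :+ (x :+ (r :+ t :* (x :+ z))) :* (y :+ (s :+ t :* (y :+ u)))
      := ((x :* x) :* (s :* s) :+ (y :* y) :* (r :* r) :+ (x :+ r) :* (y :+ s))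
         :+ t :* ((x :+ z) :* (s :+ y) :+ (y :+ u) :* (r :+ x))
         :+ (t :* t) :* ((x :* x) :* (u :* u) :+ (y :* y) :* (z :* z) :+ (x :+ z) :* (y :+ u))) refl x y z u r s t

    μ-shift : ∀ t n → μ (shift t n) ≡ μ n
    μ-shift t (r , s) = solve 7 (λ x y z u r s t →
        (x :+ z) :* ((s :+ t :* (y :+ u)) :+ y) :+ (y :+ u) :* ((r :+ t :* (x :+ z)) :+ x)
      := (x :+ z) :* (s :+ y) :+ (y :+ u) :* (r :+ x)) refl x y z u r s t

    μ-+ : ∀ r s r′ s′ → μ (r , s) + μ (r′ , s′) ≡ p * (s + s′) + q * (r + r′)
    μ-+ r s r′ s′ = solve 8 (λ x y p q r s r′ s′ →
        (p :* (s :+ y) :+ q :* (r :+ x)) :+ (p :* (s′ :+ y) :+ q :* (r′ :+ x))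
      := p :* (s :+ s′) :+ q :* (r :+ r′)) refl x y p q r s r′ s′

    μ-l : μ l ≡ 0#
    μ-l = solve 4 (λ x y p q → p :* (y :+ y) :+ q :* (x :+ x) := con false) refl x y p q

    ρ̂-l-l : ρ̂ l l ≡ 0#
    ρ̂-l-l = solve 2 (λ x y → (x :* x) :* (y :* y) :+ (y :* y) :* (x :* x) :+ (x :+ x) :* (y :+ y) := con false) refl x y

    ρ̂-l-mm : ρ̂ l mm ≡ sq (x * q + y * p) + p * q
    ρ̂-l-mm = solve 4 (λ x y z u →
        (x :* x) :* (u :* u) :+ (y :* y) :* (z :* z) :+ (x :+ z) :* (y :+ u)
      := (x :* (y :+ u) :+ y :* (x :+ z)) :* (x :* (y :+ u) :+ y :* (x :+ z)) :+ (x :+ z) :* (y :+ u)) refl x y z u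

    shift-0 : ∀ n → shift 0# n ≡ n
    shift-0 (r , s) = cong₂ _,_ (solve 2 (λ r p → r :+ con false :* p := r) refl r p)
                                (solve 2 (λ s q → s :+ con false :* q := s) refl s q)

    module _ (l≢mm : l ≢ mm) (ρ̂[l,mm]≡0 : ρ̂ l mm ≡ 0#) where

      p≢0∨q≢0 : p ≢ 0# ⊎ q ≢ 0#
      p≢0∨q≢0 with p ≟ 0# | q ≟ 0#
      ... | no p≢0 | _ = inj₁ p≢0
      ... | yes _ | no q≢0 = inj₂ q≢0
      ... | yes p≡0 | yes q≡0 = ⊥-elim (l≢mm (cong₂ _,_ (x+y≡0⇒x≡y p≡0) (x+y≡0⇒x≡y q≡0)))

      l-secant : Secant l
      l-secant = Tr[xy]≡0 p≢0∨q≢0 (trans (sym ρ̂-l-mm) ρ̂[l,mm]≡0)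

      ρ̂-l-shift : ∀ t n → ρ̂ l (shift t n) ≡ ρ̂ l n + t * μ n
      ρ̂-l-shift t n = begin
        ρ̂ l (shift t n)                          ≡⟨ ρ̂-shift t n ⟩
        ρ̂ l n + t * μ n + sq t * ρ̂ l mm          ≡⟨ cong (λ e → ρ̂ l n + t * μ n + sq t * e) ρ̂[l,mm]≡0 ⟩
        ρ̂ l n + t * μ n + sq t * 0#              ≡⟨ cong (ρ̂ l n + t * μ n +_) (zeroʳ (sq t)) ⟩
        ρ̂ l n + t * μ n + 0#                     ≡⟨ +-identityʳ _ ⟩
        ρ̂ l n + t * μ n                          ∎
        where open ≡-Reasoning

      μ-fibre : ∀ {n n′} → μ n ≡ μ n′ → ∃[ t ] n′ ≡ shift t n
      μ-fibre {r , s} {r′ , s′} μn≡μn′ =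
        let (t , r+r′≡tp , s+s′≡tq) = collinear p≢0∨q≢0 difference≡0 in
        t , cong₂ _,_ (x+y≡z⇒y≡x+z r+r′≡tp) (x+y≡z⇒y≡x+z s+s′≡tq)
        where
        difference≡0 : p * (s + s′) + q * (r + r′) ≡ 0#
        difference≡0 = trans (sym (μ-+ r s r′ s′)) (trans (cong (_+ μ (r′ , s′)) μn≡μn′) (x+x≡0 _))

      μ-onto : ∀ μ₀ → ∃[ n ] μ n ≡ μ₀
      μ-onto μ₀ with p≢0∨q≢0
      ... | inj₁ p≢0 = let (t , tp≡μ₀) = quotient p≢0 μ₀ in (x , y + t) ,
        trans (solve 5 (λ x y p q t → p :* ((y :+ t) :+ y) :+ q :* (x :+ x) := t :* p) refl x y p q t) tp≡μ₀
      ... | inj₂ q≢0 = let (t , tq≡μ₀) = quotient q≢0 μ₀ in (x + t , y) ,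
        trans (solve 5 (λ x y p q t → p :* (y :+ y) :+ q :* ((x :+ t) :+ x) := t :* q) refl x y p q t) tq≡μ₀

      μ-pencil : ∀ t → μ (pencil t) ≡ 0#
      μ-pencil t = trans (μ-shift t l) μ-l

      ρ̂-pencil : ∀ t → ρ̂ l (pencil t) ≡ 0#
      ρ̂-pencil t = begin
        ρ̂ l (pencil t)       ≡⟨ ρ̂-l-shift t l ⟩
        ρ̂ l l + t * μ l      ≡⟨ cong₂ (λ a b → a + t * b) ρ̂-l-l μ-l ⟩
        0# + t * 0#          ≡⟨ trans (+-identityˡ _) (zeroʳ t) ⟩
        0#                   ∎
        where open ≡-Reasoning

      pencil-injective : ∀ {t t′} → pencil t ≡ pencil t′ → t ≡ t′
      pencil-injective {t} {t′} eq with p≢0∨q≢0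
      ... | inj₁ p≢0 = *-cancelʳ-≢0 p≢0 (+-cancelˡ x _ _ (cong proj₁ eq))
      ... | inj₂ q≢0 = *-cancelʳ-≢0 q≢0 (+-cancelˡ y _ _ (cong proj₂ eq))

      μ≡0⇒pencil : ∀ {n} → μ n ≡ 0# → ∃[ t ] n ≡ pencil t
      μ≡0⇒pencil μn≡0 = μ-fibre (trans μ-l (sym μn≡0))

      fibre-unique : ∀ {n n′} → μ n ≡ μ n′ → μ n ≢ 0# → ρ̂ l n ≡ ρ̂ l n′ → n ≡ n′
      fibre-unique {n} {n′} μn≡μn′ μn≢0 ρ̂n≡ρ̂n′ = let (t , n′≡shift) = μ-fibre μn≡μn′ in
        [ (λ t≡0 → sym (trans n′≡shift (trans (cong (λ t → shift t n) t≡0) (shift-0 n))))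
        , ⊥-elim ∘ μn≢0
        ]′ (x*y≡0⇒x≡0∨y≡0 (tμn≡0 t n′≡shift))
        where
        tμn≡0 : ∀ t → n′ ≡ shift t n → t * μ n ≡ 0#
        tμn≡0 t n′≡shift = sym (+-cancelˡ (ρ̂ l n) _ _ (begin
          ρ̂ l n + 0#              ≡⟨ +-identityʳ _ ⟩
          ρ̂ l n                   ≡⟨ ρ̂n≡ρ̂n′ ⟩
          ρ̂ l n′                  ≡⟨ cong (ρ̂ l) n′≡shift ⟩
          ρ̂ l (shift t n)         ≡⟨ ρ̂-l-shift t n ⟩
          ρ̂ l n + t * μ n         ∎))
          where open ≡-Reasoning

      fibre-exists : ∀ {μ₀} → μ₀ ≢ 0# → ∀ c → ∃[ n ] μ n ≡ μ₀ × ρ̂ l n ≡ c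
      fibre-exists {μ₀} μ₀≢0 c with μ-onto μ₀
      ... | n₀ , μn₀≡μ₀ with quotient μ₀≢0 (ρ̂ l n₀ + c)
      ...   | t , tμ₀≡ρ̂+c = shift t n₀ , trans (μ-shift t n₀) μn₀≡μ₀ , (begin
        ρ̂ l (shift t n₀)             ≡⟨ ρ̂-l-shift t n₀ ⟩
        ρ̂ l n₀ + t * μ n₀            ≡⟨ cong (λ e → ρ̂ l n₀ + t * e) μn₀≡μ₀ ⟩
        ρ̂ l n₀ + t * μ₀              ≡⟨ cong (ρ̂ l n₀ +_) tμ₀≡ρ̂+c ⟩
        ρ̂ l n₀ + (ρ̂ l n₀ + c)        ≡⟨ sym (x+y≡z⇒y≡x+z refl) ⟩
        c                            ∎)
        where open ≡-Reasoning

      module _ (a b : F) where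

        Sol : Line → Set
        Sol n = ρ̂ l n ≡ a × ρ̂ n mm ≡ b

        ρ̂[n,mm] : ∀ {n} → ρ̂ l n ≡ a → ρ̂ n mm ≡ a + ℘ (μ n)
        ρ̂[n,mm] {n} ρ̂[l,n]≡a = begin
          ρ̂ n mm                        ≡⟨ ρ̂-decomposition n ⟩
          ρ̂ l n + ρ̂ l mm + ℘ (μ n)      ≡⟨ cong₂ (λ e f → e + f + ℘ (μ n)) ρ̂[l,n]≡a ρ̂[l,mm]≡0 ⟩
          a + 0# + ℘ (μ n)              ≡⟨ cong (_+ ℘ (μ n)) (+-identityʳ a) ⟩
          a + ℘ (μ n)                   ∎
          where open ≡-Reasoning

        Sol-℘ : ∀ {n} → Sol n → ℘ (μ n) ≡ a + b
        Sol-℘ (ρ̂[l,n]≡a , ρ̂[n,mm]≡b) = x+y≡z⇒y≡x+z (trans (sym (ρ̂[n,mm] ρ̂[l,n]≡a)) ρ̂[n,mm]≡b)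

        Sol-intro : ∀ {n} → ρ̂ l n ≡ a → ℘ (μ n) ≡ a + b → Sol n
        Sol-intro ρ̂[l,n]≡a ℘μ≡a+b = ρ̂[l,n]≡a ,
          trans (ρ̂[n,mm] ρ̂[l,n]≡a) (trans (cong (a +_) ℘μ≡a+b) (sym (x+y≡z⇒y≡x+z refl)))

        Sol-pencil : a ≡ 0# → a + b ≡ 0# → ∀ t → Sol (pencil t)
        Sol-pencil a≡0 a+b≡0 t = Sol-intro (trans (ρ̂-pencil t) (sym a≡0))
          (trans (cong ℘ (μ-pencil t)) (trans ℘0≡0 (sym a+b≡0)))

        Sol-μ≡0⇒a≡0 : ∀ {n} → Sol n → μ n ≡ 0# → a ≡ 0#
        Sol-μ≡0⇒a≡0 (ρ̂[l,n]≡a , _) μn≡0 = let (t , n≡pencil) = μ≡0⇒pencil μn≡0 in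
          trans (sym ρ̂[l,n]≡a) (trans (cong (ρ̂ l) n≡pencil) (ρ̂-pencil t))

        lineWith : ∀ {μ₀} → μ₀ ≢ 0# → Line
        lineWith μ₀≢0 = proj₁ (fibre-exists μ₀≢0 a)

        μ-lineWith : ∀ {μ₀} (μ₀≢0 : μ₀ ≢ 0#) → μ (lineWith μ₀≢0) ≡ μ₀
        μ-lineWith μ₀≢0 = proj₁ (proj₂ (fibre-exists μ₀≢0 a))

        ρ̂-lineWith : ∀ {μ₀} (μ₀≢0 : μ₀ ≢ 0#) → ρ̂ l (lineWith μ₀≢0) ≡ a
        ρ̂-lineWith μ₀≢0 = proj₂ (proj₂ (fibre-exists μ₀≢0 a))

        Sol-lineWith : ∀ {μ₀} (μ₀≢0 : μ₀ ≢ 0#) → ℘ μ₀ ≡ a + b → Sol (lineWith μ₀≢0)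
        Sol-lineWith μ₀≢0 ℘μ₀≡a+b =
          Sol-intro (ρ̂-lineWith μ₀≢0) (trans (cong ℘ (μ-lineWith μ₀≢0)) ℘μ₀≡a+b)

        Sol⇒lineWith : ∀ {n μ₀} (μ₀≢0 : μ₀ ≢ 0#) → Sol n → μ n ≡ μ₀ → n ≡ lineWith μ₀≢0
        Sol⇒lineWith μ₀≢0 (ρ̂[l,n]≡a , _) μn≡μ₀ = fibre-unique (trans μn≡μ₀ (sym (μ-lineWith μ₀≢0)))
          (λ μn≡0 → μ₀≢0 (trans (sym μn≡μ₀) μn≡0)) (trans ρ̂[l,n]≡a (sym (ρ̂-lineWith μ₀≢0)))

        count-a≡b≡0 : a ≡ 0# → b ≡ 0# → countN l mm a b ≡ suc Q
        count-a≡b≡0 a≡0 b≡0 = trans (countN-enumeration unique (mk⇔ to from)) length-S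
          where
          a+b≡0 : a + b ≡ 0#
          a+b≡0 = trans (cong₂ _+_ a≡0 b≡0) (+-identityʳ 0#)
          n₁ = lineWith 1≢0
          S = map pencil elems ++ n₁ ∷ []
          length-S : length S ≡ suc Q
          length-S = trans (length-++ (map pencil elems))
            (trans (cong (ℕ._+ 1) (trans (length-map pencil elems) elems-card)) (ℕ.+-comm Q 1))
          unique : Unique S
          unique = Unique.++⁺ (Unique.map⁺ pencil-injective elems-unique) ([] ∷ []) λ where
            (n∈pencil , here refl) → let (t , _ , n₁≡pencil) = ∈-map⁻ pencil n∈pencil in
              0≢1 (trans (sym (μ-pencil t)) (trans (cong μ (sym n₁≡pencil)) (μ-lineWith 1≢0)))
          to : ∀ {n} → Sol n → n ∈ S
          to {n} sol = [ on-pencil , (λ μn≡1 → ∈-++⁺ʳ (map pencil elems) (here (Sol⇒lineWith 1≢0 sol μn≡1))) ]′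
                         (℘≡0⇒0∨1 (trans (Sol-℘ sol) a+b≡0))
            where
            on-pencil : μ n ≡ 0# → n ∈ S
            on-pencil μn≡0 = let (t , n≡pencil) = μ≡0⇒pencil μn≡0 in
              ∈-++⁺ˡ (subst (_∈ map pencil elems) (sym n≡pencil) (∈-map⁺ pencil (elems-complete t)))
          from-n₁ : ∀ {n} → n ∈ n₁ ∷ [] → Sol n
          from-n₁ (here refl) = Sol-lineWith 1≢0 (trans ℘1≡0 (sym a+b≡0))
          from-pencil : ∀ {n} → n ∈ map pencil elems → Sol n
          from-pencil n∈pencil = let (t , _ , n≡pencil) = ∈-map⁻ pencil n∈pencil in
            subst Sol (sym n≡pencil) (Sol-pencil a≡0 a+b≡0 t)
          from : ∀ {n} → n ∈ S → Sol n
          from n∈S = [ from-pencil , from-n₁ ]′ (∈-++⁻ (map pencil elems) n∈S)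

        count-a≡b≢0 : a ≡ b → a ≢ 0# → countN l mm a b ≡ 1
        count-a≡b≢0 refl a≢0 = countN-enumeration ([] ∷ []) (mk⇔ to from)
          where
          to : ∀ {n} → Sol n → n ∈ lineWith 1≢0 ∷ []
          to sol = [ ⊥-elim ∘ a≢0 ∘ Sol-μ≡0⇒a≡0 sol , (λ μn≡1 → here (Sol⇒lineWith 1≢0 sol μn≡1)) ]′
                     (℘≡0⇒0∨1 (trans (Sol-℘ sol) (x+x≡0 a)))
          from : ∀ {n} → n ∈ lineWith 1≢0 ∷ [] → Sol n
          from (here refl) = Sol-lineWith 1≢0 (trans ℘1≡0 (sym (x+x≡0 a)))

        count-T₀* : Tr (a + b) ≡ 0# → a + b ≢ 0# → countN l mm a b ≡ 2
        count-T₀* Tr[a+b]≡0 a+b≢0 with ℘-onto-T₀ Tr[a+b]≡0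
        ... | w , ℘w≡a+b = countN-enumeration unique (mk⇔ to from)
          where
          w≢0 : w ≢ 0#
          w≢0 w≡0 = a+b≢0 (trans (sym ℘w≡a+b) (trans (cong ℘ w≡0) ℘0≡0))
          ℘[w+1]≡℘w : ℘ (w + 1#) ≡ ℘ w
          ℘[w+1]≡℘w = solve 1 (λ w → (w :+ con true) :* (w :+ con true) :+ (w :+ con true) := w :* w :+ w) refl w
          w+1≢0 : w + 1# ≢ 0#
          w+1≢0 w+1≡0 = a+b≢0 (trans (sym ℘w≡a+b) (trans (cong ℘ (x+y≡0⇒x≡y w+1≡0)) ℘1≡0))
          S = lineWith w≢0 ∷ lineWith w+1≢0 ∷ []
          unique : Unique S
          unique = ((λ n≡n′ → 0≢1 (+-cancelˡ w _ _ (trans (+-identityʳ w)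
                     (trans (sym (μ-lineWith w≢0)) (trans (cong μ n≡n′) (μ-lineWith w+1≢0)))))) ∷ [])
                   ∷ [] ∷ []
          to : ∀ {n} → Sol n → n ∈ S
          to sol = [ (λ μn≡w → here (Sol⇒lineWith w≢0 sol μn≡w)) , (λ μn≡w+1 → there (here (Sol⇒lineWith w+1≢0 sol μn≡w+1))) ]′
                     (℘-fibre (trans (Sol-℘ sol) (sym ℘w≡a+b)))
          from : ∀ {n} → n ∈ S → Sol n
          from (here refl) = Sol-lineWith w≢0 ℘w≡a+b
          from (there (here refl)) = Sol-lineWith w+1≢0 (trans ℘[w+1]≡℘w ℘w≡a+b)

mainTheorem15 : ∀ {m : ℕ} (K : GF2^ m) → let open GF2^ K in
    (a b : F) (l mm : Line) → l ≢ mm → ρ̂ l mm ≡ 0# →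
      (Exterior l → countN l mm a b ≡ 0)
      × (Secant l →
          ((a ≡ 0# → b ≡ 0# → countN l mm a b ≡ suc Q)
          × (a ≡ b → a ≢ 0# → countN l mm a b ≡ 1)
          × (Tr (a + b) ≡ 0# → a + b ≢ 0# → countN l mm a b ≡ 2)))
mainTheorem15 K a b (x , y) (z , u) l≢mm ρ̂[l,mm]≡0 =
  (λ exterior → ⊥-elim (0≢1 (trans (sym (l-secant l≢mm ρ̂[l,mm]≡0)) exterior))) ,
  (λ _ → count-a≡b≡0 l≢mm ρ̂[l,mm]≡0 a b , count-a≡b≢0 l≢mm ρ̂[l,mm]≡0 a b , count-T₀* l≢mm ρ̂[l,mm]≡0 a b)
  where
  open GF2^ K using (0≢1)
  open Pencil K x y z u
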